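{- Let $\omega$ be a permutation, $k,m$ positive integers, and let $\mathcal T\in k_{(m)}\cdot\mathcal T_\omega$ have labels $(1,a_1,b_1),\ldots,(m,a_m,b_m)$ with $b_1,\ldots,b_m$ pairwise distinct. Then the sequence $(a_1,b_1),\ldots,(a_m,b_m)$ can be rearranged as $(a_1',b_1'),\ldots,(a_m',b_m')$ so that (1) there is a labelled tower diagram $\mathcal T'\in k_{(m)}\cdot\mathcal T_\omega$ with labels $(1,a_1',b_1'),\ldots,(m,a_m',b_m')$, (2) $\omega_{\mathcal T}=\omega_{\mathcal T'}$, and (3) $a_1'\ge a_2'\ge\cdots\ge a_m'$.
   Context: Permutations compose as functions; $t_{a,b}$ transposes $a,b$; $\ell$ is Coxeter length. For a permutation $w$, $\mathcal T_w$ denotes its tower diagram (a sequence of nonnegative integers attached bijectively to $w$; its precise definition is not needed here), and $\omega_{\mathcal T}$ is the permutation whose tower diagram is $\mathcal T$. A saturated $k$-Bruhat chain of length $m$ from $\omega$ is a sequence $(a_1,b_1),\ldots,(a_m,b_m)$ of pairs of positive integers with $a_q\le k<b_q$ and $\ell(\omega^{(q)})=\ell(\omega^{(q-1)})+1$ for all $q$, where $\omega^{(0)}=\omega$, $\omega^{(q)}=\omega^{(q-1)}t_{a_q,b_q}$. The set $k_{(m)}\cdot\mathcal T_\omega$ consists, for each such chain, of the tower diagram $\mathcal T_{\omega^{(m)}}$ labelled by $(1,a_1,b_1),\ldots,(m,a_m,b_m)$; the underlying permutation of this labelled diagram is $\omega^{(m)}$. -}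

module Defs where

open import Data.Nat using (ℕ; zero; suc; _+_; _≤_; _<_; _⊔_; _≡ᵇ_; _<ᵇ_)
open import Data.Bool using (if_then_else_)
open import Data.Product using (_×_; _,_)
open import Data.List using (List; []; _∷_)
open import Data.Unit using (⊤)
open import Relation.Binary.PropositionalEquality using (_≡_)
open import Function.Definitions using (Injective)

-- A permutation is represented by its action on ℕ (positive integers are the
-- genuine domain; 0 is required to be fixed), together with a bound N such
-- that all i ≥ N are fixed.  Composition is as functions: (w t)(i) = w (t i).

swap : ℕ → ℕ → ℕ → ℕ
swap a b i = if i ≡ᵇ a then b else (if i ≡ᵇ b then a else i)

IsPerm : (ℕ → ℕ) → ℕ → Set
IsPerm ω N = (ω 0 ≡ 0) × ((i : ℕ) → N ≤ i → ω i ≡ i) × Injective _≡_ _≡_ ω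

record BPerm : Set where
  constructor ⟨_,_⟩
  field
    fun : ℕ → ℕ
    bnd : ℕ
open BPerm public

_·t[_,_] : BPerm → ℕ → ℕ → BPerm
⟨ f , N ⟩ ·t[ a , b ] = ⟨ (λ i → f (swap a b i)) , N ⊔ suc b ⟩

invBelow : (ℕ → ℕ) → ℕ → ℕ → ℕ
invBelow f j zero = 0
invBelow f j (suc i) = (if f j <ᵇ f i then 1 else 0) + invBelow f j i

inv : (ℕ → ℕ) → ℕ → ℕ
inv f zero = 0
inv f (suc N) = invBelow f N N + inv f N

ℓ : BPerm → ℕ
ℓ w = inv (fun w) (bnd w)

-- saturated k-Bruhat chain from w: pairs (a,b) with 1 ≤ a ≤ k < b,
-- each step raising the length by exactly one
IsKChain : ℕ → BPerm → List (ℕ × ℕ) → Set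
IsKChain k w [] = ⊤
IsKChain k w ((a , b) ∷ c) =
  (1 ≤ a) × (a ≤ k) × (k < b) × (ℓ (w ·t[ a , b ]) ≡ suc (ℓ w)) × IsKChain k (w ·t[ a , b ]) c

endPerm : BPerm → List (ℕ × ℕ) → BPerm
endPerm w [] = w
endPerm w ((a , b) ∷ c) = endPerm (w ·t[ a , b ]) c

module Submission where

-- The key local fact is then the
-- exchange lemma: two consecutive covering steps (a,b),(a',b') with a < a'
-- and b ≠ b' (all a's ≤ k < all b's) can be performed in the opposite order,
-- and since the two transpositions commute the end permutation is unchanged.
-- Insertion sort on the first coordinates, using only such exchanges, turns a
-- chain with distinct b's into one with weakly decreasing a's: the theorem.

open import Defs
open import Data.Nat using (ℕ; zero; suc; _+_; _≤_; _<_; _≥_; _≡ᵇ_; _<ᵇ_; _⊔_; z≤n; z<s; _<?_; _≤?_)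
open import Data.Nat.Properties
open import Data.Bool using (true; false; if_then_else_)
open import Data.Bool.Properties using (T-≡; ¬-not)
open import Data.Product using (_×_; _,_; proj₁; proj₂; ∃-syntax)
open import Data.Sum using (_⊎_; inj₁; inj₂)
open import Data.Empty using (⊥; ⊥-elim)
open import Data.Unit using (⊤; tt)
open import Data.List using (List; []; _∷_; length; map)
open import Data.List.Relation.Unary.All using (All; []; _∷_) renaming (map to All-map)
open import Data.List.Relation.Unary.All.Properties using () renaming (map⁻ to All-map⁻)
open import Data.List.Relation.Unary.AllPairs using (AllPairs; []; _∷_)
open import Data.List.Relation.Unary.Unique.Propositional using (Unique)
open import Data.List.Relation.Unary.Linked using (Linked)
open import Data.List.Relation.Unary.Linked.Properties using (AllPairs⇒Linked) renaming (map⁺ to Linked-map⁺)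
open import Data.List.Relation.Binary.Permutation.Propositional using (_↭_; prep) renaming (refl to ↭-refl; trans to ↭-trans; swap to ↭-swap)
open import Data.List.Relation.Binary.Permutation.Propositional.Properties using (All-resp-↭)
open import Function using (_on_)
open import Function.Bundles using (_⇔_; mk⇔; Equivalence)
open import Function.Definitions using (Injective)
open import Relation.Binary using (tri<; tri≈; tri>)
open import Relation.Binary.PropositionalEquality using (_≡_; refl; sym; trans; cong; cong₂; subst; subst₂; _≢_; module ≡-Reasoning)
open import Relation.Nullary using (yes; no)
open import Data.Nat.Solver using (module +-*-Solver)
open +-*-Solver

≡ᵇ-true : ∀ m n → m ≡ n → (m ≡ᵇ n) ≡ true
≡ᵇ-true m n p = Equivalence.to T-≡ (≡⇒≡ᵇ m n p)

≡ᵇ-false : ∀ m n → m ≢ n → (m ≡ᵇ n) ≡ false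
≡ᵇ-false m n p = ¬-not (λ e → p (≡ᵇ⇒≡ m n (Equivalence.from T-≡ e)))

<ᵇ-true : ∀ m n → m < n → (m <ᵇ n) ≡ true
<ᵇ-true m n p = Equivalence.to T-≡ (<⇒<ᵇ p)

<ᵇ-false : ∀ m n → n ≤ m → (m <ᵇ n) ≡ false
<ᵇ-false m n p = ¬-not (λ e → <⇒≱ (<ᵇ⇒< m n (Equivalence.from T-≡ e)) p)

swap-left : ∀ a b → swap a b a ≡ b
swap-left a b rewrite ≡ᵇ-true a a refl = refl

swap-right : ∀ a b → a ≢ b → swap a b b ≡ a
swap-right a b a≢b rewrite ≡ᵇ-false b a (λ e → a≢b (sym e)) | ≡ᵇ-true b b refl = refl

swap-other : ∀ a b i → i ≢ a → i ≢ b → swap a b i ≡ i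
swap-other a b i i≢a i≢b rewrite ≡ᵇ-false i a i≢a | ≡ᵇ-false i b i≢b = refl

swap-involutive : ∀ a b → a ≢ b → ∀ i → swap a b (swap a b i) ≡ i
swap-involutive a b a≢b i with i ≟ a | i ≟ b
... | yes refl | _ rewrite swap-left a b = swap-right a b a≢b
... | no _ | yes refl rewrite swap-right a b a≢b = swap-left a b
... | no i≢a | no i≢b rewrite swap-other a b i i≢a i≢b = swap-other a b i i≢a i≢b

swap-injective : ∀ (f : ℕ → ℕ) a b → a ≢ b → Injective _≡_ _≡_ f →
  Injective _≡_ _≡_ (λ i → f (swap a b i))
swap-injective f a b a≢b inj {x} {y} e =
  trans (sym (swap-involutive a b a≢b x)) (trans (cong (swap a b) (inj e)) (swap-involutive a b a≢b y))

swap-commute : ∀ a b a′ b′ → a ≢ b → a′ ≢ b′ → a ≢ a′ → a ≢ b′ → b ≢ a′ → b ≢ b′ →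
  ∀ i → swap a b (swap a′ b′ i) ≡ swap a′ b′ (swap a b i)
swap-commute a b a′ b′ ab a′b′ aa′ ab′ ba′ bb′ i with i ≟ a | i ≟ b | i ≟ a′ | i ≟ b′
... | yes refl | _ | _ | _ rewrite swap-other a′ b′ a aa′ ab′ | swap-left a b = sym (swap-other a′ b′ b ba′ bb′)
... | no _ | yes refl | _ | _ rewrite swap-other a′ b′ b ba′ bb′ | swap-right a b ab = sym (swap-other a′ b′ a aa′ ab′)
... | no p | no q | yes refl | _ rewrite swap-left a′ b′ | swap-other a b a′ p q =
  trans (swap-other a b b′ (λ e → ab′ (sym e)) (λ e → bb′ (sym e))) (sym (swap-left a′ b′))
... | no p | no q | no _ | yes refl rewrite swap-right a′ b′ a′b′ | swap-other a b b′ p q =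
  trans (swap-other a b a′ (λ e → aa′ (sym e)) (λ e → ba′ (sym e))) (sym (swap-right a′ b′ a′b′))
... | no p | no q | no r | no t rewrite swap-other a′ b′ i r t | swap-other a b i p q = sym (swap-other a′ b′ i r t)

[_<_] : ℕ → ℕ → ℕ
[ x < y ] = if x <ᵇ y then 1 else 0

[<]-yes : ∀ x y → x < y → [ x < y ] ≡ 1
[<]-yes x y p rewrite <ᵇ-true x y p = refl

[<]-no : ∀ x y → y ≤ x → [ x < y ] ≡ 0
[<]-no x y p rewrite <ᵇ-false x y p = refl

Sum : (ℕ → ℕ) → ℕ → ℕ
Sum h zero = 0
Sum h (suc n) = h n + Sum h n

Sum-cong : ∀ h h′ n → (∀ i → i < n → h i ≡ h′ i) → Sum h n ≡ Sum h′ n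
Sum-cong h h′ zero p = refl
Sum-cong h h′ (suc n) p = cong₂ _+_ (p n ≤-refl) (Sum-cong h h′ n (λ i q → p i (m≤n⇒m≤1+n q)))

Sum-+ : ∀ h h′ n → Sum (λ i → h i + h′ i) n ≡ Sum h n + Sum h′ n
Sum-+ h h′ zero = refl
Sum-+ h h′ (suc n) rewrite Sum-+ h h′ n =
  solve 4 (λ x y z w → (x :+ y) :+ (z :+ w) := (x :+ z) :+ (y :+ w)) refl (h n) (h′ n) (Sum h n) (Sum h′ n)

Sum-mono : ∀ h h′ n → (∀ i → i < n → h i ≤ h′ i) → Sum h n ≤ Sum h′ n
Sum-mono h h′ zero p = z≤n
Sum-mono h h′ (suc n) p = +-mono-≤ (p n ≤-refl) (Sum-mono h h′ n (λ i q → p i (m≤n⇒m≤1+n q)))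

Sum-mono-gap : ∀ h h′ n → (∀ i → i < n → h i ≤ h′ i) → ∀ c → c < n → 2 + h c ≤ h′ c →
  2 + Sum h n ≤ Sum h′ n
Sum-mono-gap h h′ (suc n) p c c<n q with m≤n⇒m<n∨m≡n (≤-pred c<n)
... | inj₂ refl = subst (_≤ h′ c + Sum h′ c) (+-assoc 2 (h c) (Sum h c))
        (+-mono-≤ q (Sum-mono h h′ c (λ i r → p i (m≤n⇒m≤1+n r))))
... | inj₁ c<n′ = subst (_≤ h′ n + Sum h′ n)
        (solve 3 (λ x y z → y :+ (x :+ z) := x :+ (y :+ z)) refl 2 (h n) (Sum h n))
        (+-mono-≤ (p n ≤-refl) (Sum-mono-gap h h′ n (λ i r → p i (m≤n⇒m≤1+n r)) c c<n′ q))

Above : ℕ → (ℕ → ℕ) → ℕ → ℕ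
Above a h j = if a <ᵇ j then h j else 0

Above-yes : ∀ a h j → a < j → Above a h j ≡ h j
Above-yes a h j p rewrite <ᵇ-true a j p = refl

Above-no : ∀ a h j → j ≤ a → Above a h j ≡ 0
Above-no a h j p rewrite <ᵇ-false a j p = refl

Sum-Above-empty : ∀ a h n → n ≤ suc a → Sum (Above a h) n ≡ 0
Sum-Above-empty a h zero p = refl
Sum-Above-empty a h (suc n) p rewrite Above-no a h n (≤-pred p) =
  Sum-Above-empty a h n (m≤n⇒m≤1+n (≤-pred p))

Sum-Above-+ : ∀ a h h′ n → Sum (Above a (λ j → h j + h′ j)) n ≡ Sum (Above a h) n + Sum (Above a h′) n
Sum-Above-+ a h h′ n = trans (Sum-cong _ _ n (λ j _ → pointwise j)) (Sum-+ (Above a h) (Above a h′) n)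
  where
  pointwise : ∀ j → Above a (λ j → h j + h′ j) j ≡ Above a h j + Above a h′ j
  pointwise j with a <ᵇ j
  ... | true = refl
  ... | false = refl

Sum-split : ∀ a h n → a < n → Sum h n ≡ Sum h (suc a) + Sum (Above a h) n
Sum-split a h (suc n) p with m≤n⇒m<n∨m≡n (≤-pred p)
... | inj₂ refl rewrite Above-no a h a ≤-refl | Sum-Above-empty a h a (n≤1+n a) = sym (+-identityʳ _)
... | inj₁ a<n rewrite Above-yes a h n a<n | Sum-split a h n a<n =
  solve 3 (λ x y z → x :+ (y :+ z) := y :+ (x :+ z)) refl (h n) (Sum h (suc a)) (Sum (Above a h) n)

module SumUnderSwap (a b : ℕ) (a<b : a < b) (h : ℕ → ℕ) where

  below : ∀ j → j ≤ a → Sum (λ i → h (swap a b i)) j ≡ Sum h j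
  below j j≤a = Sum-cong _ _ j (λ i i<j → cong h (swap-other a b i (<⇒≢ (<-≤-trans i<j j≤a))
                 (<⇒≢ (<-trans (<-≤-trans i<j j≤a) a<b))))

  between : ∀ j → a < j → j ≤ b → Sum (λ i → h (swap a b i)) j + h a ≡ Sum h j + h b
  between (suc j) a<j j≤b with m≤n⇒m<n∨m≡n (≤-pred a<j)
  ... | inj₂ refl rewrite swap-left a b | below a ≤-refl =
    solve 3 (λ x y z → (x :+ y) :+ z := (z :+ y) :+ x) refl (h b) (Sum h a) (h a)
  ... | inj₁ a<j′ rewrite swap-other a b j (λ e → <⇒≢ a<j′ (sym e)) (<⇒≢ j≤b)
    | +-assoc (h j) (Sum (λ i → h (swap a b i)) j) (h a) | between j a<j′ (<⇒≤ j≤b) =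
    sym (+-assoc (h j) (Sum h j) (h b))

  beyond : ∀ j → b < j → Sum (λ i → h (swap a b i)) j ≡ Sum h j
  beyond (suc j) b<j with m≤n⇒m<n∨m≡n (≤-pred b<j)
  ... | inj₂ refl rewrite swap-right a b (<⇒≢ a<b) =
    trans (+-comm (h a) _) (trans (between b a<b ≤-refl) (+-comm (Sum h b) (h b)))
  ... | inj₁ b<j′ rewrite swap-other a b j (λ e → <⇒≢ (<-trans a<b b<j′) (sym e)) (λ e → <⇒≢ b<j′ (sym e))
    | beyond j b<j′ = refl

col : (ℕ → ℕ) → ℕ → ℕ
col f j = Sum (λ i → [ f j < f i ]) j

invBelow≡Sum : ∀ f j i → invBelow f j i ≡ Sum (λ x → [ f j < f x ]) i
invBelow≡Sum f j zero = refl
invBelow≡Sum f j (suc i) = cong ([ f j < f i ] +_) (invBelow≡Sum f j i)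

inv≡Sum-col : ∀ f M → inv f M ≡ Sum (col f) M
inv≡Sum-col f zero = refl
inv≡Sum-col f (suc M) = cong₂ _+_ (invBelow≡Sum f M M) (inv≡Sum-col f M)

-- It is proved by comparing the column sums of g and f on the ranges
-- [0,a], (a,b] and beyond b.
module InversionIdentity (f : ℕ → ℕ) (a b : ℕ) (a<b : a < b) where
  g : ℕ → ℕ
  g i = f (swap a b i)

  highA highB : ℕ
  highA = Sum (λ i → [ f a < f i ]) a
  highB = Sum (λ i → [ f b < f i ]) a

  lowA lowB : ℕ → ℕ
  lowA j = [ f j < f a ]
  lowB j = [ f j < f b ]

  outer inner : ℕ → ℕ
  outer j = [ f j < f a ] + [ f b < f j ]
  inner j = [ f j < f b ] + [ f a < f j ]

  col-below : ∀ j → j < a → col g j ≡ col f j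
  col-below j j<a = trans (SumUnderSwap.below a b a<b (λ x → [ f (swap a b j) < f x ]) j (<⇒≤ j<a))
    (cong (λ v → Sum (λ x → [ f v < f x ]) j) (swap-other a b j (<⇒≢ j<a) (<⇒≢ (<-trans j<a a<b))))

  col-at-a : col g a ≡ highB
  col-at-a = trans (SumUnderSwap.below a b a<b (λ x → [ f (swap a b a) < f x ]) a ≤-refl)
    (cong (λ v → Sum (λ x → [ f v < f x ]) a) (swap-left a b))

  col-between : ∀ j → a < j → j < b → col g j + lowA j ≡ col f j + lowB j
  col-between j a<j j<b with SumUnderSwap.between a b a<b (λ x → [ f (swap a b j) < f x ]) j a<j (<⇒≤ j<b)
  ... | e rewrite swap-other a b j (λ e → <⇒≢ a<j (sym e)) (<⇒≢ j<b) = e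

  col-at-b : col g b ≡ Sum (λ i → [ f a < f i ]) b + [ f a < f b ]
  col-at-b with SumUnderSwap.between a b a<b (λ x → [ f (swap a b b) < f x ]) b a<b ≤-refl
  ... | e rewrite swap-right a b (<⇒≢ a<b) | [<]-no (f a) (f a) ≤-refl = trans (sym (+-identityʳ _)) e

  col-beyond : ∀ j → b < j → col g j ≡ col f j
  col-beyond j b<j = trans (SumUnderSwap.beyond a b a<b (λ x → [ f (swap a b j) < f x ]) j b<j)
    (cong (λ v → Sum (λ x → [ f v < f x ]) j)
      (swap-other a b j (λ e → <⇒≢ (<-trans a<b b<j) (sym e)) (λ e → <⇒≢ b<j (sym e))))

  prefix-below : ∀ M → M ≤ a → Sum (col g) M ≡ Sum (col f) M
  prefix-below zero _ = refl
  prefix-below (suc M) p = cong₂ _+_ (col-below M p) (prefix-below M (<⇒≤ p))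

  prefix-between : ∀ M → a < M → M ≤ b →
    Sum (col g) M + highA + Sum (Above a lowA) M ≡ Sum (col f) M + highB + Sum (Above a lowB) M
  prefix-between (suc M) p q with m≤n⇒m<n∨m≡n (≤-pred p)
  ... | inj₂ refl rewrite col-at-a | prefix-below a ≤-refl
        | Sum-Above-empty a lowA (suc a) ≤-refl | Sum-Above-empty a lowB (suc a) ≤-refl =
    solve 3 (λ x y z → (x :+ y) :+ z :+ con 0 := (z :+ y) :+ x :+ con 0) refl highB (Sum (col f) a) highA
  ... | inj₁ a<M rewrite Above-yes a lowA M a<M | Above-yes a lowB M a<M =
    trans (solve 5 (λ c i x y z → (c :+ i) :+ x :+ (y :+ z) := (c :+ y) :+ (i :+ x :+ z)) refl
             (col g M) (Sum (col g) M) highA (lowA M) (Sum (Above a lowA) M))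
     (trans (cong₂ _+_ (col-between M a<M q) (prefix-between M a<M (<⇒≤ q)))
       (solve 5 (λ c i x y z → (c :+ y) :+ (i :+ x :+ z) := (c :+ i) :+ x :+ (y :+ z)) refl
             (col f M) (Sum (col f) M) highB (lowB M) (Sum (Above a lowB) M)))

  highA′ : ℕ
  highA′ = Sum (λ i → [ f a < f i ]) b

  prefix-beyond : ∀ M → b < M → Sum (col g) M + highA + Sum (Above a lowA) b + col f b
                    ≡ Sum (col f) M + highB + Sum (Above a lowB) b + highA′ + [ f a < f b ]
  prefix-beyond (suc M) p with m≤n⇒m<n∨m≡n (≤-pred p)
  ... | inj₂ refl rewrite col-at-b =
    trans (solve 6 (λ s l i x y c → (s :+ l :+ i) :+ x :+ y :+ c := (i :+ x :+ y) :+ (c :+ s :+ l)) refl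
             highA′ [ f a < f b ] (Sum (col g) b) highA (Sum (Above a lowA) b) (col f b))
     (trans (cong (_+ (col f b + highA′ + [ f a < f b ])) (prefix-between b a<b ≤-refl))
       (solve 6 (λ s l i x y c → (i :+ x :+ y) :+ (c :+ s :+ l) := (c :+ i) :+ x :+ y :+ s :+ l) refl
             highA′ [ f a < f b ] (Sum (col f) b) highB (Sum (Above a lowB) b) (col f b)))
  ... | inj₁ b<M rewrite col-beyond M b<M =
    trans (solve 5 (λ c i x y z → (c :+ i) :+ x :+ y :+ z := c :+ (i :+ x :+ y :+ z)) refl
             (col f M) (Sum (col g) M) highA (Sum (Above a lowA) b) (col f b))
     (trans (cong (col f M +_) (prefix-beyond M b<M))
       (solve 6 (λ c i x y z w → c :+ (i :+ x :+ y :+ z :+ w) := (c :+ i) :+ x :+ y :+ z :+ w) refl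
             (col f M) (Sum (col f) M) highB (Sum (Above a lowB) b) highA′ [ f a < f b ]))

  inversion-identity : ∀ M → b < M →
    inv g M + [ f b < f a ] + Sum (Above a outer) b ≡ inv f M + [ f a < f b ] + Sum (Above a inner) b
  inversion-identity M b<M = +-cancelʳ-≡ (highA + highB) _ _ (trans lhs (trans (prefix-beyond M b<M) rhs))
    where
    highB-above highA-above : ℕ
    highB-above = Sum (Above a (λ i → [ f b < f i ])) b
    highA-above = Sum (Above a (λ i → [ f a < f i ])) b
    col-f-b : col f b ≡ [ f b < f a ] + highB + highB-above
    col-f-b = Sum-split a (λ i → [ f b < f i ]) b a<b
    highA′-split : highA′ ≡ 0 + highA + highA-above
    highA′-split = trans (Sum-split a (λ i → [ f a < f i ]) b a<b)
          (cong (λ v → v + highA + highA-above) ([<]-no (f a) (f a) ≤-refl))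
    lhs : inv g M + [ f b < f a ] + Sum (Above a outer) b + (highA + highB)
       ≡ Sum (col g) M + highA + Sum (Above a lowA) b + col f b
    lhs rewrite inv≡Sum-col g M | Sum-Above-+ a lowA (λ j → [ f b < f j ]) b | col-f-b =
      solve 6 (λ i l x y u v → i :+ l :+ (x :+ y) :+ (u :+ v) := i :+ u :+ x :+ (l :+ v :+ y)) refl
        (Sum (col g) M) [ f b < f a ] (Sum (Above a lowA) b) highB-above highA highB
    rhs : Sum (col f) M + highB + Sum (Above a lowB) b + highA′ + [ f a < f b ]
       ≡ inv f M + [ f a < f b ] + Sum (Above a inner) b + (highA + highB)
    rhs rewrite inv≡Sum-col f M | Sum-Above-+ a lowB (λ j → [ f a < f j ]) b | highA′-split =
      solve 6 (λ i l x y u v → i :+ v :+ x :+ (con 0 :+ u :+ y) :+ l := i :+ l :+ (x :+ y) :+ (u :+ v)) refl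
        (Sum (col f) M) [ f a < f b ] (Sum (Above a lowB) b) highA-above highA highB

-- f ∘ t_{a,b} covers f in the Bruhat order: f a < f b, and no position
-- strictly between a and b carries a value strictly between f a and f b.
Covers : (ℕ → ℕ) → ℕ → ℕ → Set
Covers f a b = (f a < f b) × (∀ c → a < c → c < b → f a < f c → f c < f b → ⊥)

weights-in-gap : ∀ A B x → A < x → x < B → 2 + ([ x < A ] + [ B < x ]) ≤ [ x < B ] + [ A < x ]
weights-in-gap A B x A<x x<B rewrite [<]-no x A (<⇒≤ A<x) | [<]-no B x (<⇒≤ x<B)
  | [<]-yes x B x<B | [<]-yes A x A<x = ≤-refl

weights-increasing : ∀ A B x → A < B → x ≢ A → x ≢ B →
  ([ x < A ] + [ B < x ] ≡ [ x < B ] + [ A < x ]) ⊎ (A < x × x < B)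
weights-increasing A B x A<B x≢A x≢B with <-cmp x A
... | tri≈ _ x≡A _ = ⊥-elim (x≢A x≡A)
... | tri< x<A _ _ rewrite [<]-yes x A x<A | [<]-no B x (<⇒≤ (<-trans x<A A<B))
        | [<]-yes x B (<-trans x<A A<B) | [<]-no A x (<⇒≤ x<A) = inj₁ refl
... | tri> _ _ A<x with <-cmp x B
...   | tri≈ _ x≡B _ = ⊥-elim (x≢B x≡B)
...   | tri< x<B _ _ = inj₂ (A<x , x<B)
...   | tri> _ _ B<x rewrite [<]-no x A (<⇒≤ A<x) | [<]-yes B x B<x
        | [<]-no x B (<⇒≤ B<x) | [<]-yes A x A<x = inj₁ refl

weights-decreasing : ∀ A B x → B < A → x ≢ A → x ≢ B → [ x < B ] + [ A < x ] ≤ [ x < A ] + [ B < x ]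
weights-decreasing A B x B<A x≢A x≢B with <-cmp x B
... | tri≈ _ x≡B _ = ⊥-elim (x≢B x≡B)
... | tri< x<B _ _ rewrite [<]-yes x A (<-trans x<B B<A) | [<]-no B x (<⇒≤ x<B)
        | [<]-yes x B x<B | [<]-no A x (<⇒≤ (<-trans x<B B<A)) = ≤-refl
... | tri> _ _ B<x with <-cmp x A
...   | tri≈ _ x≡A _ = ⊥-elim (x≢A x≡A)
...   | tri< x<A _ _ rewrite [<]-yes x A x<A | [<]-yes B x B<x | [<]-no x B (<⇒≤ B<x) | [<]-no A x (<⇒≤ x<A) = z≤n
...   | tri> _ _ A<x rewrite [<]-no x A (<⇒≤ A<x) | [<]-yes B x B<x | [<]-no x B (<⇒≤ B<x) | [<]-yes A x A<x = ≤-refl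

Above-cong : ∀ a h h′ i → (a < i → h i ≡ h′ i) → Above a h i ≡ Above a h′ i
Above-cong a h h′ i p with a <? i
... | yes a<i rewrite Above-yes a h i a<i | Above-yes a h′ i a<i = p a<i
... | no a≮i rewrite Above-no a h i (≮⇒≥ a≮i) | Above-no a h′ i (≮⇒≥ a≮i) = refl

Above-mono : ∀ a h h′ i → (a < i → h i ≤ h′ i) → Above a h i ≤ Above a h′ i
Above-mono a h h′ i p with a <? i
... | yes a<i rewrite Above-yes a h i a<i | Above-yes a h′ i a<i = p a<i
... | no a≮i rewrite Above-no a h i (≮⇒≥ a≮i) | Above-no a h′ i (≮⇒≥ a≮i) = z≤n

module CoveringCriterion (f : ℕ → ℕ) (inj : Injective _≡_ _≡_ f) (a b M : ℕ) (a<b : a < b) (b<M : b < M) where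
  open InversionIdentity f a b a<b

  Σouter Σinner : ℕ
  Σouter = Sum (Above a outer) b
  Σinner = Sum (Above a inner) b

  ≢-at-a : ∀ j → a < j → f j ≢ f a
  ≢-at-a j a<j e = <⇒≢ a<j (sym (inj e))

  ≢-at-b : ∀ j → j < b → f j ≢ f b
  ≢-at-b j j<b e = <⇒≢ j<b (inj e)

  outer≤inner : f a < f b → ∀ i → i < b → Above a outer i ≤ Above a inner i
  outer≤inner fa<fb i i<b = Above-mono a outer inner i compare
    where
    compare : a < i → outer i ≤ inner i
    compare a<i with weights-increasing (f a) (f b) (f i) fa<fb (≢-at-a i a<i) (≢-at-b i i<b)
    ... | inj₁ same = ≤-reflexive same
    ... | inj₂ (x , y) = ≤-trans (m≤n+m _ 2) (weights-in-gap (f a) (f b) (f i) x y)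

  inner≤outer : f b < f a → ∀ i → i < b → Above a inner i ≤ Above a outer i
  inner≤outer fb<fa i i<b = Above-mono a inner outer i
    (λ a<i → weights-decreasing (f a) (f b) (f i) fb<fa (≢-at-a i a<i) (≢-at-b i i<b))

  covers⇒sums-equal : Covers f a b → Σouter ≡ Σinner
  covers⇒sums-equal (fa<fb , no-gap) = Sum-cong _ _ b (λ i i<b → Above-cong a outer inner i (compare i i<b))
    where
    compare : ∀ i → i < b → a < i → outer i ≡ inner i
    compare i i<b a<i with weights-increasing (f a) (f b) (f i) fa<fb (≢-at-a i a<i) (≢-at-b i i<b)
    ... | inj₁ same = same
    ... | inj₂ (x , y) = ⊥-elim (no-gap i a<i i<b x y)

  -- A value in the gap would make Σinner exceed Σouter by at least 2.
  sums-equal⇒no-gap : f a < f b → Σouter ≡ Σinner →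
    ∀ c → a < c → c < b → f a < f c → f c < f b → ⊥
  sums-equal⇒no-gap fa<fb same c a<c c<b x y =
    1+n≰n (≤-trans (n≤1+n _) (subst (2 + Σouter ≤_) (sym same) (Sum-mono-gap _ _ b (outer≤inner fa<fb) c c<b gap)))
    where
    gap : 2 + Above a outer c ≤ Above a inner c
    gap rewrite Above-yes a outer c a<c | Above-yes a inner c a<c = weights-in-gap (f a) (f b) (f c) x y

  covers⇒inv-step : Covers f a b → inv g M ≡ suc (inv f M)
  covers⇒inv-step cv@(fa<fb , _) = +-cancelʳ-≡ Σinner (inv g M) (suc (inv f M)) (begin
    inv g M + Σinner                  ≡⟨ cong (_+ Σinner) (sym (+-identityʳ _)) ⟩
    inv g M + 0 + Σinner              ≡⟨ cong (λ x → inv g M + x + Σinner) (sym ([<]-no (f b) (f a) (<⇒≤ fa<fb))) ⟩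
    inv g M + [ f b < f a ] + Σinner ≡⟨ cong (inv g M + [ f b < f a ] +_) (sym (covers⇒sums-equal cv)) ⟩
    inv g M + [ f b < f a ] + Σouter ≡⟨ inversion-identity M b<M ⟩
    inv f M + [ f a < f b ] + Σinner ≡⟨ cong (λ x → inv f M + x + Σinner) ([<]-yes (f a) (f b) fa<fb) ⟩
    inv f M + 1 + Σinner              ≡⟨ cong (_+ Σinner) (+-comm (inv f M) 1) ⟩
    suc (inv f M) + Σinner            ∎)
    where open ≡-Reasoning

  inv-step⇒covers : inv g M ≡ suc (inv f M) → Covers f a b
  inv-step⇒covers step with inversion-identity M b<M | <-cmp (f a) (f b)
  ... | _ | tri≈ _ fa≡fb _ = ⊥-elim (<⇒≢ a<b (inj fa≡fb))
  ... | identity | tri> _ _ fb<fa rewrite step | [<]-yes (f b) (f a) fb<fa | [<]-no (f a) (f b) (<⇒≤ fb<fa) =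
    ⊥-elim (<⇒≱ (subst (Σouter <_) inner≡2+outer (m<n+m Σouter z<s)) (Sum-mono _ _ b (inner≤outer fb<fa)))
    where
    inner≡2+outer : 2 + Σouter ≡ Σinner
    inner≡2+outer = +-cancelˡ-≡ (inv f M) _ _
      (trans (solve 2 (λ x y → x :+ (con 2 :+ y) := con 1 :+ x :+ con 1 :+ y) refl (inv f M) Σouter)
        (trans identity (+-assoc (inv f M) 0 _)))
  ... | identity | tri< fa<fb _ _ rewrite step | [<]-no (f b) (f a) (<⇒≤ fa<fb) | [<]-yes (f a) (f b) fa<fb =
    fa<fb , sums-equal⇒no-gap fa<fb outer≡inner
    where
    outer≡inner : Σouter ≡ Σinner
    outer≡inner = +-cancelˡ-≡ (suc (inv f M)) _ _
      (trans (sym (cong (_+ Σouter) (+-identityʳ _)))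
        (trans identity (cong (_+ Σinner) (+-comm (inv f M) 1))))

-- Consequences of IsPerm f N: f maps [0, N) into itself, so positions ≥ N
-- contribute no inversions and the inversion count stabilises at N.
module BoundedPermutation (f : ℕ → ℕ) (N : ℕ) (pf : IsPerm f N) where
  fixed : ∀ i → N ≤ i → f i ≡ i
  fixed = proj₁ (proj₂ pf)

  injective : Injective _≡_ _≡_ f
  injective = proj₂ (proj₂ pf)

  maps-below : ∀ i → i < N → f i < N
  maps-below i i<N with <-cmp (f i) N
  ... | tri< p _ _ = p
  ... | tri≈ _ e _ = ⊥-elim (<⇒≢ i<N (trans (sym (injective (fixed (f i) (≤-reflexive (sym e))))) e))
  ... | tri> _ _ p = ⊥-elim (<⇒≱ i<N (≤-trans (<⇒≤ p) (≤-reflexive (injective (fixed (f i) (<⇒≤ p))))))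

  invBelow-vanishes : ∀ M → N ≤ M → ∀ i → i ≤ M → invBelow f M i ≡ 0
  invBelow-vanishes M N≤M zero _ = refl
  invBelow-vanishes M N≤M (suc i) i<M rewrite fixed M N≤M | invBelow-vanishes M N≤M i (<⇒≤ i<M) with <-cmp i N
  ... | tri< i<N _ _ rewrite <ᵇ-false M (f i) (<⇒≤ (<-≤-trans (maps-below i i<N) N≤M)) = refl
  ... | tri≈ _ e _ rewrite fixed i (≤-reflexive (sym e)) | <ᵇ-false M i (<⇒≤ i<M) = refl
  ... | tri> _ _ p rewrite fixed i (<⇒≤ p) | <ᵇ-false M i (<⇒≤ i<M) = refl

  inv-stable : ∀ M → N ≤ M → inv f M ≡ inv f N
  inv-stable M N≤M with m≤n⇒m<n∨m≡n N≤M
  ... | inj₂ refl = refl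
  inv-stable (suc M) _ | inj₁ N<M rewrite invBelow-vanishes M (≤-pred N<M) M ≤-refl = inv-stable M (≤-pred N<M)

perm-swap : ∀ f N a b → IsPerm f N → 1 ≤ a → a < b → IsPerm (λ i → f (swap a b i)) (N ⊔ suc b)
perm-swap f N a b (f0 , fixed , inj) 1≤a a<b = zero-fixed , fixed′ , swap-injective f a b (<⇒≢ a<b) inj
  where
  zero-fixed : f (swap a b 0) ≡ 0
  zero-fixed rewrite swap-other a b 0 (<⇒≢ 1≤a) (<⇒≢ (<-≤-trans 1≤a (<⇒≤ a<b))) = f0
  fixed′ : ∀ i → N ⊔ suc b ≤ i → f (swap a b i) ≡ i
  fixed′ i p rewrite swap-other a b i (λ e → <⇒≱ (<-trans a<b (≤-trans (m≤n⊔m N (suc b)) p)) (≤-reflexive e))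
                                     (λ e → <⇒≱ (≤-trans (m≤n⊔m N (suc b)) p) (≤-reflexive e))
    = fixed i (≤-trans (m≤m⊔n N (suc b)) p)

ℓ-step⇔Covers : ∀ f N a b → IsPerm f N → a < b →
  (ℓ (⟨ f , N ⟩ ·t[ a , b ]) ≡ suc (ℓ ⟨ f , N ⟩)) ⇔ Covers f a b
ℓ-step⇔Covers f N a b pf a<b =
  mk⇔ (λ step → inv-step⇒covers (subst (λ v → inv g M ≡ suc v) (sym stable) step))
      (λ cv → subst (λ v → inv g M ≡ suc v) stable (covers⇒inv-step cv))
  where
  M = N ⊔ suc b
  open CoveringCriterion f (BoundedPermutation.injective f N pf) a b M a<b (m≤n⊔m N (suc b))
  open InversionIdentity f a b a<b using (g)
  stable : inv f M ≡ inv f N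
  stable = BoundedPermutation.inv-stable f N pf M (m≤m⊔n N (suc b))

-- Saturated k-Bruhat chains described by covering steps; unlike IsKChain this
-- only involves the underlying function, not its bound.
CoverChain : ℕ → (ℕ → ℕ) → List (ℕ × ℕ) → Set
CoverChain k f [] = ⊤
CoverChain k f ((a , b) ∷ c) = (1 ≤ a) × (a ≤ k) × (k < b) × Covers f a b × CoverChain k (λ i → f (swap a b i)) c

IsKChain⇒CoverChain : ∀ k f N c → IsPerm f N → IsKChain k ⟨ f , N ⟩ c → CoverChain k f c
IsKChain⇒CoverChain k f N [] pf _ = _
IsKChain⇒CoverChain k f N ((a , b) ∷ c) pf (1≤a , a≤k , k<b , step , rest) =
  1≤a , a≤k , k<b , Equivalence.to (ℓ-step⇔Covers f N a b pf a<b) step ,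
  IsKChain⇒CoverChain k _ _ c (perm-swap f N a b pf 1≤a a<b) rest
  where a<b = ≤-<-trans a≤k k<b

CoverChain⇒IsKChain : ∀ k f N c → IsPerm f N → CoverChain k f c → IsKChain k ⟨ f , N ⟩ c
CoverChain⇒IsKChain k f N [] pf _ = _
CoverChain⇒IsKChain k f N ((a , b) ∷ c) pf (1≤a , a≤k , k<b , cv , rest) =
  1≤a , a≤k , k<b , Equivalence.from (ℓ-step⇔Covers f N a b pf a<b) cv ,
  CoverChain⇒IsKChain k _ _ c (perm-swap f N a b pf 1≤a a<b) rest
  where a<b = ≤-<-trans a≤k k<b

chainEnd : (ℕ → ℕ) → List (ℕ × ℕ) → ℕ → ℕ
chainEnd f [] = f
chainEnd f ((a , b) ∷ c) = chainEnd (λ i → f (swap a b i)) c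

endPerm≡chainEnd : ∀ f N c i → fun (endPerm ⟨ f , N ⟩ c) i ≡ chainEnd f c i
endPerm≡chainEnd f N [] i = refl
endPerm≡chainEnd f N ((a , b) ∷ c) i = endPerm≡chainEnd _ _ c i

chainEnd-cong : ∀ f f′ c → (∀ i → f i ≡ f′ i) → ∀ i → chainEnd f c i ≡ chainEnd f′ c i
chainEnd-cong f f′ [] e i = e i
chainEnd-cong f f′ ((a , b) ∷ c) e i = chainEnd-cong _ _ c (λ j → e (swap a b j)) i

Covers-cong : ∀ f f′ a b → (∀ i → f i ≡ f′ i) → Covers f a b → Covers f′ a b
Covers-cong f f′ a b e (fa<fb , no-gap) =
  subst₂ _<_ (e a) (e b) fa<fb ,
  λ c x y u v → no-gap c x y (subst₂ _<_ (sym (e a)) (sym (e c)) u) (subst₂ _<_ (sym (e c)) (sym (e b)) v)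

CoverChain-cong : ∀ k f f′ c → (∀ i → f i ≡ f′ i) → CoverChain k f c → CoverChain k f′ c
CoverChain-cong k f f′ [] e _ = _
CoverChain-cong k f f′ ((a , b) ∷ c) e (1≤a , a≤k , k<b , cv , rest) =
  1≤a , a≤k , k<b , Covers-cong f f′ a b e cv , CoverChain-cong k _ _ c (λ j → e (swap a b j)) rest

module Exchange (f : ℕ → ℕ) (inj : Injective _≡_ _≡_ f) (a b a′ b′ : ℕ)
  (a<a′ : a < a′) (a′<b : a′ < b) (a′<b′ : a′ < b′) (b≢b′ : b ≢ b′) where
  a<b : a < b
  a<b = <-trans a<a′ a′<b
  a<b′ : a < b′
  a<b′ = <-trans a<a′ a′<b′

  commute : ∀ i → swap a b (swap a′ b′ i) ≡ swap a′ b′ (swap a b i)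
  commute = swap-commute a b a′ b′ (<⇒≢ a<b) (<⇒≢ a′<b′) (<⇒≢ a<a′) (<⇒≢ a<b′) (λ e → <⇒≢ a′<b (sym e)) b≢b′

  fab fa′b′ : ℕ → ℕ
  fab i = f (swap a b i)
  fa′b′ i = f (swap a′ b′ i)

  fab-a′ : fab a′ ≡ f a′
  fab-a′ = cong f (swap-other a b a′ (λ e → <⇒≢ a<a′ (sym e)) (<⇒≢ a′<b))
  fab-b′ : fab b′ ≡ f b′
  fab-b′ = cong f (swap-other a b b′ (λ e → <⇒≢ a<b′ (sym e)) (λ e → b≢b′ (sym e)))
  fab-b : fab b ≡ f a
  fab-b = cong f (swap-right a b (<⇒≢ a<b))
  fa′b′-a : fa′b′ a ≡ f a
  fa′b′-a = cong f (swap-other a′ b′ a (<⇒≢ a<a′) (<⇒≢ a<b′))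
  fa′b′-b : fa′b′ b ≡ f b
  fa′b′-b = cong f (swap-other a′ b′ b (λ e → <⇒≢ a′<b (sym e)) b≢b′)
  fa′b′-a′ : fa′b′ a′ ≡ f b′
  fa′b′-a′ = cong f (swap-left a′ b′)
  fa′b′-b′ : fa′b′ b′ ≡ f a′
  fa′b′-b′ = cong f (swap-right a′ b′ (<⇒≢ a′<b′))

  first-step : Covers f a b → Covers fab a′ b′ → Covers f a′ b′
  first-step (c₁ , gap₁) (c₂ , gap₂) = subst₂ _<_ fab-a′ fab-b′ c₂ , no-gap
    where
    no-gap : ∀ c → a′ < c → c < b′ → f a′ < f c → f c < f b′ → ⊥
    no-gap c x y u v with c ≟ b
    ... | yes refl with <-cmp (f a) (f a′)
    ...   | tri≈ _ e _ = <⇒≢ a<a′ (inj e)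
    ...   | tri< p _ _ = gap₁ a′ a<a′ a′<b p u
    ...   | tri> _ _ p = gap₂ b x y (subst₂ _<_ (sym fab-a′) (sym fab-b) p)
                              (subst₂ _<_ (sym fab-b) (sym fab-b′) (<-trans c₁ v))
    no-gap c x y u v | no c≢b = gap₂ c x y (subst₂ _<_ (sym fab-a′) (sym fab-c) u) (subst₂ _<_ (sym fab-c) (sym fab-b′) v)
      where
      fab-c : fab c ≡ f c
      fab-c = cong f (swap-other a b c (λ e → <⇒≢ (<-trans a<a′ x) (sym e)) c≢b)

  second-step : Covers f a b → Covers fab a′ b′ → Covers fa′b′ a b
  second-step (c₁ , gap₁) (c₂ , gap₂) = subst₂ _<_ (sym fa′b′-a) (sym fa′b′-b) c₁ , no-gap
    where
    no-gap : ∀ c → a < c → c < b → fa′b′ a < fa′b′ c → fa′b′ c < fa′b′ b → ⊥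
    no-gap c x y u v with c ≟ a′ | c ≟ b′
    ... | yes refl | _ with <-cmp b′ b
    ...   | tri≈ _ e _ = b≢b′ (sym e)
    ...   | tri< b′<b _ _ = gap₁ b′ a<b′ b′<b (subst₂ _<_ fa′b′-a fa′b′-a′ u) (subst₂ _<_ fa′b′-a′ fa′b′-b v)
    ...   | tri> _ _ b<b′ with <-cmp (f a) (f a′)
    ...     | tri≈ _ e _ = <⇒≢ a<a′ (inj e)
    ...     | tri< p _ _ = gap₁ a′ a<a′ a′<b p (<-trans (subst₂ _<_ fab-a′ fab-b′ c₂) (subst₂ _<_ fa′b′-a′ fa′b′-b v))
    ...     | tri> _ _ p = gap₂ b a′<b b<b′ (subst₂ _<_ (sym fab-a′) (sym fab-b) p)
                               (subst₂ _<_ (sym fab-b) (sym fab-b′) (subst₂ _<_ fa′b′-a fa′b′-a′ u))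
    no-gap c x y u v | no _ | yes refl = gap₁ a′ a<a′ a′<b (subst₂ _<_ fa′b′-a fa′b′-b′ u) (subst₂ _<_ fa′b′-b′ fa′b′-b v)
    no-gap c x y u v | no p | no q = gap₁ c x y (subst₂ _<_ fa′b′-a fa′b′-c u) (subst₂ _<_ fa′b′-c fa′b′-b v)
      where
      fa′b′-c : fa′b′ c ≡ f c
      fa′b′-c = cong f (swap-other a′ b′ c p q)

chain-exchange : ∀ k f → Injective _≡_ _≡_ f → ∀ a b a′ b′ rest → a < a′ → b ≢ b′ →
  CoverChain k f ((a , b) ∷ (a′ , b′) ∷ rest) → CoverChain k f ((a′ , b′) ∷ (a , b) ∷ rest)
chain-exchange k f inj a b a′ b′ rest a<a′ b≢b′ (1≤a , a≤k , k<b , cv , 1≤a′ , a′≤k , k<b′ , cv′ , tail) =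
  ≤-trans 1≤a (<⇒≤ a<a′) , a′≤k , k<b′ , first-step cv cv′ ,
  1≤a , a≤k , k<b , second-step cv cv′ ,
  CoverChain-cong k _ _ rest (λ i → cong f (commute i)) tail
  where open Exchange f inj a b a′ b′ a<a′ (≤-<-trans a′≤k k<b) (≤-<-trans a′≤k k<b′) b≢b′

Decreasing : List (ℕ × ℕ) → Set
Decreasing = AllPairs (_≥_ on proj₁)

SortedRearrangement : ℕ → (ℕ → ℕ) → List (ℕ × ℕ) → Set
SortedRearrangement k f c =
  ∃[ c′ ] ((c ↭ c′) × CoverChain k f c′ × (∀ i → chainEnd f c i ≡ chainEnd f c′ i) × Decreasing c′)

insert : ∀ k f → Injective _≡_ _≡_ f → ∀ a b c → CoverChain k f ((a , b) ∷ c) → Decreasing c →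
  All (λ p → b ≢ proj₂ p) c → SortedRearrangement k f ((a , b) ∷ c)
insert k f inj a b [] chain _ _ = ((a , b) ∷ []) , ↭-refl , chain , (λ i → refl) , ([] ∷ [])
insert k f inj a b ((a′ , b′) ∷ rest) chain (head≥ ∷ sorted) (b≢b′ ∷ b≢rest) with a′ ≤? a
... | yes a′≤a = ((a , b) ∷ (a′ , b′) ∷ rest) , ↭-refl , chain , (λ i → refl) ,
                 ((a′≤a ∷ All-map (λ le → ≤-trans le a′≤a) head≥) ∷ head≥ ∷ sorted)
... | no a′≰a with chain-exchange k f inj a b a′ b′ rest (≰⇒> a′≰a) b≢b′ chain
...   | (1≤a′ , a′≤k , k<b′ , cv′ , tail)
  with insert k (λ i → f (swap a′ b′ i)) (swap-injective f a′ b′ (<⇒≢ (≤-<-trans a′≤k k<b′)) inj) a b rest tail sorted b≢rest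
...     | c″ , rest↭c″ , chain″ , same-end , sorted″ =
  ((a′ , b′) ∷ c″) , ↭-trans (↭-swap _ _ ↭-refl) (prep _ rest↭c″) , (1≤a′ , a′≤k , k<b′ , cv′ , chain″) ,
  (λ i → trans (chainEnd-cong _ _ rest (λ j → cong f (commute j)) i) (same-end i)) ,
  (All-resp-↭ rest↭c″ (<⇒≤ a<a′ ∷ head≥) ∷ sorted″)
  where
  a<a′ = ≰⇒> a′≰a
  a≤k = proj₁ (proj₂ chain)
  k<b = proj₁ (proj₂ (proj₂ chain))
  open Exchange f inj a b a′ b′ a<a′ (≤-<-trans a′≤k k<b) (≤-<-trans a′≤k k<b′) b≢b′ using (commute)

sort : ∀ k f → Injective _≡_ _≡_ f → ∀ c → CoverChain k f c → Unique (map proj₂ c) → SortedRearrangement k f c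
sort k f inj [] _ _ = [] , ↭-refl , tt , (λ i → refl) , []
sort k f inj ((a , b) ∷ c) (1≤a , a≤k , k<b , cv , tail) (b-fresh ∷ unique)
  with sort k (λ i → f (swap a b i)) (swap-injective f a b (<⇒≢ (≤-<-trans a≤k k<b)) inj) c tail unique
... | c′ , c↭c′ , chain′ , same-end , sorted′
  with insert k f inj a b c′ (1≤a , a≤k , k<b , cv , chain′) sorted′ (All-resp-↭ c↭c′ (All-map⁻ b-fresh))
... | c″ , c↭c″ , chain″ , same-end′ , sorted″ =
  c″ , ↭-trans (prep _ c↭c′) c↭c″ , chain″ , (λ i → trans (same-end i) (same-end′ i)) , sorted″

proposition6p3 : (ω : ℕ → ℕ) (N k m : ℕ) → IsPerm ω N → 1 ≤ k → 1 ≤ m →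
    (c : List (ℕ × ℕ)) → length c ≡ m → IsKChain k ⟨ ω , N ⟩ c →
    Unique (map proj₂ c) →
    ∃[ c′ ] ((c ↭ c′) × IsKChain k ⟨ ω , N ⟩ c′ ×
      ((i : ℕ) → fun (endPerm ⟨ ω , N ⟩ c) i ≡ fun (endPerm ⟨ ω , N ⟩ c′) i) ×
      Linked _≥_ (map proj₁ c′))
proposition6p3 ω N k m perm _ _ c _ chain unique
  with sort k ω (BoundedPermutation.injective ω N perm) c (IsKChain⇒CoverChain k ω N c perm chain) unique
... | c′ , c↭c′ , chain′ , same-end , sorted =
  c′ , c↭c′ , CoverChain⇒IsKChain k ω N c′ perm chain′ ,
  (λ i → trans (endPerm≡chainEnd ω N c i) (trans (same-end i) (sym (endPerm≡chainEnd ω N c′ i)))) ,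
  Linked-map⁺ (AllPairs⇒Linked sorted)
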